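{- Let $Ag$ be a finite set of agents and $\mathcal{CS}$ a constant specification. Let $(\Gamma_1,\dots,\Gamma_n,\Gamma)$ be an element (with $n\geq0$), let $\Delta\subseteq Form^{Ag}$ be $\mathcal{CS}$-maxiconsistent, and suppose $\{\Box A:\Box A\in\Gamma\}\subseteq\Delta$. Then $(\Gamma_1,\dots,\Gamma_n,\Delta)$ is also an element, and $(\Gamma_1,\dots,\Gamma_n,\Gamma)\equiv(\Gamma_1,\dots,\Gamma_n,\Delta)$.
   Context: Language: finite $Ag$; countably infinite $PVar$, $PConst$, $Var$; $Pol$: $t ::= x\mid c\mid s+t\mid s\times t\mid\ !t$; $Form^{Ag}$: $A ::= p\mid A\wedge B\mid\neg A\mid[j]A\mid\Box A\mid t{:}A\mid KA\mid Prove(j,t,A)\mid Proven(t,A)$; $\Diamond$, $\langle j\rangle$ duals. System $\Pi$: axiom schemes (A0) propositional tautologies; (A1) S5 for $\Box$ and each $[j]$; (A2) $\Box A\to[j]A$; (A3) $(\Diamond[j_1]A_1\wedge\dots\wedge\Diamond[j_n]A_n)\to\Diamond([j_1]A_1\wedge\dots\wedge[j_n]A_n)$, $j_k$ pairwise distinct; (A4) $s{:}(A\to B)\to(t{:}A\to(s\times t){:}B)$; (A5) $t{:}A\to(!t{:}(t{:}A)\wedge KA)$; (A6) $(s{:}A\vee t{:}A)\to(s+t){:}A$; (A7) S4 for $K$; (A8) $KA\to\Box K\Box A$; (B9) $Prove(j,t,A)\to(\neg Proven(t,A)\wedge[j]Prove(j,t,A)\wedge\neg\Box Prove(j,t,A)\wedge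 t{:}A)$; (B10) $(Prove(j,t,A)\wedge t{:}B)\to Prove(j,t,B)$; (B11) $Proven(t,A)\to(KProven(t,A)\wedge t{:}A)$; (B12) $(Proven(t,A)\wedge t{:}B)\to Proven(t,B)$; (B13) $\neg Prove(j,t,A)\to\langle j\rangle\bigwedge_{i\in Ag}\neg Prove(i,t,A)$. Rules: modus ponens; from $A$ infer $KA$; (S4) from $KA\to(\neg Proven(t_1,B_1)\vee\dots\vee\neg Proven(t_n,B_n))$ infer $KA\to(\bigwedge_{j\in Ag}\neg Prove(j,t_1,B_1)\vee\dots\vee\bigwedge_{j\in Ag}\neg Prove(j,t_n,B_n))$. Constant specification $\mathcal{CS}$: set of formulas $c_n{:}\dots c_1{:}A$ ($A$ an axiom instance) closed under removing the outer constant; $\Pi(\mathcal{CS})$ adds the rule inferring members of $\mathcal{CS}$. $\mathcal{CS}$-consistent / maxiconsistent are defined via $\Pi(\mathcal{CS})$ as usual. An element is a sequence $(\Gamma_1,\dots,\Gamma_m)$, $m\geq1$, of $\mathcal{CS}$-maxiconsistent sets such that for $k<m$: $KA\in\Gamma_k\Rightarrow KA\in\Gamma_{k+1}$, and $Prove(j,t,A)\in\Gamma_k\Rightarrow Proven(t,A)\in\Gamma_{k+1}$. For elements of equal length: $(\Gamma_1,\dots,\Gamma_n,\Gamma_{n+1})\equiv(\Delta_1,\dots,\Delta_n,\Delta_{n+1})$ iff $\Gamma_k=\Delta_k$ for all $k\leq n$ and for all $A\in Form^{Ag}$, $\Box A\in\Gamma_{n+1}$ implies $A\in\Delta_{n+1}$.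 -}

module Defs where

open import Data.Nat using (ℕ; suc)
open import Data.Bool using (Bool; true; false; not; _∧_)
open import Data.Fin using (Fin; inject₁) renaming (suc to fsuc)
open import Data.List using (List; []; _∷_; map; allFin)
open import Data.List.NonEmpty using (List⁺; _∷_; toList)
open import Data.List.Relation.Unary.All using (All)
open import Data.List.Relation.Unary.Unique.Propositional using (Unique)
open import Data.Vec using (Vec; lookup; last)
open import Data.Product using (_×_; proj₁; proj₂)
open import Data.Sum using (_⊎_)
open import Relation.Binary.PropositionalEquality using (_≡_)
open import Relation.Nullary using (¬_)
open import Function using (_⇔_)

data Pol : Set where
  pvar   : ℕ → Pol
  pconst : ℕ → Pol
  _⊕_    : Pol → Pol → Pol
  _⊗_    : Pol → Pol → Pol
  !_     : Pol → Pol

module Lang (k : ℕ) where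

  Ag : Set
  Ag = Fin k

  infixr 6 _∧'_
  infixr 5 _∨'_
  infix 8 _∶_
  infix 9 ¬'_ □_ K_ [_]_ ◇_ ⟨_⟩_
  data Form : Set where
    atom    : ℕ → Form
    _∧'_    : Form → Form → Form
    ¬'_     : Form → Form
    [_]_    : Ag → Form → Form
    □_      : Form → Form
    _∶_     : Pol → Form → Form
    K_      : Form → Form
    Prove   : Ag → Pol → Form → Form
    Proven  : Pol → Form → Form

  infixr 4 _⇒_
  _⇒_ : Form → Form → Form
  A ⇒ B = ¬' (A ∧' ¬' B)

  _∨'_ : Form → Form → Form
  A ∨' B = ¬' (¬' A ∧' ¬' B)

  ◇_ : Form → Form
  ◇ A = ¬' □ ¬' A

  ⟨_⟩_ : Ag → Form → Form
  ⟨ j ⟩ A = ¬' [ j ] ¬' A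

  ⊥' : Form
  ⊥' = atom 0 ∧' ¬' atom 0

  ⊤' : Form
  ⊤' = ¬' ⊥'

  ⋀ : List Form → Form
  ⋀ []           = ⊤'
  ⋀ (A ∷ [])     = A
  ⋀ (A ∷ B ∷ As) = A ∧' ⋀ (B ∷ As)

  ⋀⁺ : List⁺ Form → Form
  ⋀⁺ (A ∷ As) = ⋀ (A ∷ As)

  ⋁ : Form → List Form → Form
  ⋁ A []       = A
  ⋁ A (B ∷ As) = A ∨' ⋁ B As

  ⋁⁺ : List⁺ Form → Form
  ⋁⁺ (A ∷ As) = ⋁ A As

  noneProve : Pol → Form → Form
  noneProve t A = ⋀ (map (λ i → ¬' Prove i t A) (allFin k))

  -- classical truth-functional evaluation; formulas whose main connective is
  -- not ∧ or ¬ are treated as propositional atoms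
  eval : (Form → Bool) → Form → Bool
  eval v (A ∧' B) = eval v A ∧ eval v B
  eval v (¬' A)   = not (eval v A)
  eval v A        = v A

  Tautology : Form → Set
  Tautology A = (v : Form → Bool) → eval v A ≡ true

  data Axiom : Form → Set where
    A0      : ∀ {A} → Tautology A → Axiom A
    A1□K    : ∀ A B → Axiom (□ (A ⇒ B) ⇒ (□ A ⇒ □ B))
    A1□T    : ∀ A → Axiom (□ A ⇒ A)
    A1□5    : ∀ A → Axiom (◇ A ⇒ □ ◇ A)
    A1jK    : ∀ j A B → Axiom ([ j ] (A ⇒ B) ⇒ ([ j ] A ⇒ [ j ] B))
    A1jT    : ∀ j A → Axiom ([ j ] A ⇒ A)
    A1j5    : ∀ j A → Axiom (⟨ j ⟩ A ⇒ [ j ] ⟨ j ⟩ A)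
    A2      : ∀ j A → Axiom (□ A ⇒ [ j ] A)
    A3      : (ps : List⁺ (Ag × Form)) → Unique (map proj₁ (toList ps)) →
              Axiom (⋀⁺ (Data.List.NonEmpty.map (λ p → ◇ [ proj₁ p ] proj₂ p) ps)
                     ⇒ ◇ ⋀⁺ (Data.List.NonEmpty.map (λ p → [ proj₁ p ] proj₂ p) ps))
    A4      : ∀ s t A B → Axiom (s ∶ (A ⇒ B) ⇒ (t ∶ A ⇒ (s ⊗ t) ∶ B))
    A5      : ∀ t A → Axiom (t ∶ A ⇒ ((! t) ∶ (t ∶ A) ∧' K A))
    A6      : ∀ s t A → Axiom ((s ∶ A ∨' t ∶ A) ⇒ (s ⊕ t) ∶ A)
    A7K     : ∀ A B → Axiom (K (A ⇒ B) ⇒ (K A ⇒ K B))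
    A7T     : ∀ A → Axiom (K A ⇒ A)
    A74     : ∀ A → Axiom (K A ⇒ K K A)
    A8      : ∀ A → Axiom (K A ⇒ □ K □ A)
    B9      : ∀ j t A → Axiom (Prove j t A ⇒
                ⋀ (¬' Proven t A ∷ [ j ] Prove j t A ∷ ¬' □ Prove j t A ∷ t ∶ A ∷ []))
    B10     : ∀ j t A B → Axiom ((Prove j t A ∧' t ∶ B) ⇒ Prove j t B)
    B11     : ∀ t A → Axiom (Proven t A ⇒ (K Proven t A ∧' t ∶ A))
    B12     : ∀ t A B → Axiom ((Proven t A ∧' t ∶ B) ⇒ Proven t B)
    B13     : ∀ j t A → Axiom (¬' Prove j t A ⇒ ⟨ j ⟩ noneProve t A)

  data CSFormula : Form → Set where
    one  : ∀ c {A} → Axiom A → CSFormula (pconst c ∶ A)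
    more : ∀ c {B} → CSFormula B → CSFormula (pconst c ∶ B)

  Pred : Set₁
  Pred = Form → Set

  record IsCS (CS : Pred) : Set where
    field
      shape  : ∀ {F} → CS F → CSFormula F
      closed : ∀ c {B} → CS (pconst c ∶ B) → CSFormula B → CS B

  infix 2 _⊢_
  data _⊢_ (CS : Pred) : Form → Set where
    ax     : ∀ {A} → Axiom A → CS ⊢ A
    cs     : ∀ {A} → CS A → CS ⊢ A
    mp     : ∀ {A B} → CS ⊢ (A ⇒ B) → CS ⊢ A → CS ⊢ B
    necK   : ∀ {A} → CS ⊢ A → CS ⊢ K A
    ruleS4 : ∀ {A} (ps : List⁺ (Pol × Form)) →
             CS ⊢ (K A ⇒ ⋁⁺ (Data.List.NonEmpty.map (λ p → ¬' Proven (proj₁ p) (proj₂ p)) ps)) →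
             CS ⊢ (K A ⇒ ⋁⁺ (Data.List.NonEmpty.map (λ p → noneProve (proj₁ p) (proj₂ p)) ps))

  Consistent : Pred → Pred → Set
  Consistent CS Γ = (L : List Form) → All Γ L → ¬ (CS ⊢ (⋀ L ⇒ ⊥'))

  MaxCons : Pred → Pred → Set
  MaxCons CS Γ = Consistent CS Γ × (∀ A → Consistent CS (λ B → Γ B ⊎ B ≡ A) → Γ A)

  record IsElement (CS : Pred) {n : ℕ} (Γs : Vec Pred (suc n)) : Set where
    field
      maxcons : (i : Fin (suc n)) → MaxCons CS (lookup Γs i)
      keepK   : (i : Fin n) (A : Form) →
                lookup Γs (inject₁ i) (K A) → lookup Γs (fsuc i) (K A)
      proven  : (i : Fin n) (j : Ag) (t : Pol) (A : Form) →
                lookup Γs (inject₁ i) (Prove j t A) → lookup Γs (fsuc i) (Proven t A)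

  _≐_ : Pred → Pred → Set
  Γ ≐ Δ = ∀ A → Γ A ⇔ Δ A

  infix 2 _≡ₑ_
  record _≡ₑ_ {n : ℕ} (Γs Δs : Vec Pred (suc n)) : Set where
    field
      prefix : (i : Fin n) → lookup Γs (inject₁ i) ≐ lookup Δs (inject₁ i)
      boxes  : ∀ A → last Γs (□ A) → last Δs A

-- The proof has four layers.
--   1. A small propositional toolkit for ⊢, obtained from axiom (A0) via a
--      generic truth-table checker for boolean functions.
--   2. Maxiconsistent sets are closed under provable implication.
--   3. Modal transfer: if every □A ∈ Γ lies in Δ, then A ∈ Δ for □A ∈ Γ (by T
--      for □), KA ∈ Γ gives KA ∈ Δ (via (A8) KA → □K□A and K□A → KA), and
--      Proven(t,A) ∈ Γ gives Proven(t,A) ∈ Δ (via (B11) and T for K).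
--   4. Element bookkeeping: the conditions of an element only constrain the
--      last set through the K- and Proven-formulas it must inherit from its
--      predecessor, so any maxiconsistent Δ inheriting all of Γ's K- and
--      Proven-formulas may replace Γ; the ≡-relation only asks that the
--      prefixes agree and that □A ∈ Γ implies A ∈ Δ.
module Submission where

open import Defs
open import Level using (Level)
open import Data.Nat using (ℕ; zero; suc)
open import Data.Bool using (Bool; true; false; not; _∧_; T)
open import Data.Bool.Properties using (T-∧; T-≡)
open import Data.Fin using (Fin; inject₁; fromℕ) renaming (zero to fzero; suc to fsuc)
open import Data.Vec using (Vec; []; _∷_; _∷ʳ_; lookup)
open import Data.Vec.Properties using (last-∷ʳ)
open import Data.List using (List; []; _∷_)
open import Data.List.Relation.Unary.All using (All; []; _∷_)
open import Data.List.Relation.Binary.Pointwise using (Pointwise; []; _∷_)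
open import Data.Product using (_×_; _,_; Σ-syntax; proj₁; proj₂)
open import Data.Sum using (_⊎_; inj₁; inj₂)
open import Relation.Binary.PropositionalEquality using (_≡_; refl; sym; subst)
open import Function using (mk⇔; Equivalence)

BoolFun : ℕ → Set
BoolFun zero    = Bool
BoolFun (suc n) = Bool → BoolFun n

Valid : (n : ℕ) → BoolFun n → Set
Valid zero    b = b ≡ true
Valid (suc n) f = ∀ p → Valid n (f p)

truthTable : (n : ℕ) → BoolFun n → Bool
truthTable zero    b = b
truthTable (suc n) f = truthTable n (f false) ∧ truthTable n (f true)

truthTable-sound : ∀ n (f : BoolFun n) → T (truthTable n f) → Valid n f
truthTable-sound zero    b h     = Equivalence.to T-≡ h
truthTable-sound (suc n) f h false = truthTable-sound n (f false) (proj₁ (Equivalence.to T-∧ h))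
truthTable-sound (suc n) f h true  = truthTable-sound n (f true)  (proj₂ (Equivalence.to T-∧ h))

-- Boolean implication; eval v (A ⇒ B) unfolds to eval v A ⇒ᵇ eval v B.
_⇒ᵇ_ : Bool → Bool → Bool
p ⇒ᵇ q = not (p ∧ not q)

module _ {a : Level} {A : Set a} where

  lookup-∷ʳ-inject₁ : ∀ {n} (xs : Vec A n) (x : A) (i : Fin n) →
                      lookup (xs ∷ʳ x) (inject₁ i) ≡ lookup xs i
  lookup-∷ʳ-inject₁ (y ∷ xs) x fzero    = refl
  lookup-∷ʳ-inject₁ (y ∷ xs) x (fsuc i) = lookup-∷ʳ-inject₁ xs x i

  lookup-∷ʳ-fromℕ : ∀ {n} (xs : Vec A n) (x : A) → lookup (xs ∷ʳ x) (fromℕ n) ≡ x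
  lookup-∷ʳ-fromℕ []       x = refl
  lookup-∷ʳ-fromℕ (y ∷ xs) x = lookup-∷ʳ-fromℕ xs x

  lookup-∷ʳ-transport : ∀ {ℓ} {n} (P : A → Set ℓ) (xs : Vec A n) {x y : A} →
                        (P x → P y) → (p : Fin (suc n)) →
                        P (lookup (xs ∷ʳ x) p) → P (lookup (xs ∷ʳ y) p)
  lookup-∷ʳ-transport P []       x→y fzero    = x→y
  lookup-∷ʳ-transport P (z ∷ xs) x→y fzero    h = h
  lookup-∷ʳ-transport P (z ∷ xs) x→y (fsuc p) = lookup-∷ʳ-transport P xs x→y p

module _ {k : ℕ} where
  open Lang k

  module _ {CS : Pred} where

    -- Propositional toolkit: each principle is an instance of (A0); the
    -- certificate '_' is solved because the truth table computes to true.

    ⊢-refl : ∀ {P} → CS ⊢ P ⇒ P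
    ⊢-refl {P} = ax (A0 λ v →
      truthTable-sound 1 (λ p → p ⇒ᵇ p) _ (eval v P))

    ⊢-∧-elimˡ : ∀ {P Q} → CS ⊢ (P ∧' Q) ⇒ P
    ⊢-∧-elimˡ {P} {Q} = ax (A0 λ v →
      truthTable-sound 2 (λ p q → (p ∧ q) ⇒ᵇ p) _ (eval v P) (eval v Q))

    ⊢-trans : ∀ {P Q R} → CS ⊢ P ⇒ Q → CS ⊢ Q ⇒ R → CS ⊢ P ⇒ R
    ⊢-trans {P} {Q} {R} P⇒Q Q⇒R = mp (mp (ax (A0 λ v →
      truthTable-sound 3 (λ p q r → (p ⇒ᵇ q) ⇒ᵇ ((q ⇒ᵇ r) ⇒ᵇ (p ⇒ᵇ r))) _
        (eval v P) (eval v Q) (eval v R))) P⇒Q) Q⇒R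

    ⊢-∧-mono : ∀ {P Q R S} → CS ⊢ P ⇒ Q → CS ⊢ R ⇒ S → CS ⊢ (P ∧' R) ⇒ (Q ∧' S)
    ⊢-∧-mono {P} {Q} {R} {S} P⇒Q R⇒S = mp (mp (ax (A0 λ v →
      truthTable-sound 4 (λ p q r s → (p ⇒ᵇ q) ⇒ᵇ ((r ⇒ᵇ s) ⇒ᵇ ((p ∧ r) ⇒ᵇ (q ∧ s)))) _
        (eval v P) (eval v Q) (eval v R) (eval v S))) P⇒Q) R⇒S

    _⊢⋆_ : List Form → List Form → Set
    _⊢⋆_ = Pointwise (λ A B → CS ⊢ A ⇒ B)

    ⋀-mono : ∀ {L′ L} → L′ ⊢⋆ L → CS ⊢ ⋀ L′ ⇒ ⋀ L
    ⋀-mono []                   = ⊢-refl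
    ⋀-mono (A⇒B ∷ [])           = A⇒B
    ⋀-mono (A⇒B ∷ rest@(_ ∷ _)) = ⊢-∧-mono A⇒B (⋀-mono rest)

    strengthen : ∀ (Δ : Pred) {B C} → Δ B → CS ⊢ B ⇒ C →
                 (L : List Form) → All (λ A → Δ A ⊎ A ≡ C) L →
                 Σ[ L′ ∈ List Form ] All Δ L′ × L′ ⊢⋆ L
    strengthen Δ B∈Δ B⇒C []      []              = [] , [] , []
    strengthen Δ B∈Δ B⇒C (A ∷ L) (inj₁ A∈Δ ∷ hs) =
      let L′ , L′⊆Δ , L′⊢L = strengthen Δ B∈Δ B⇒C L hs
      in A ∷ L′ , A∈Δ ∷ L′⊆Δ , ⊢-refl ∷ L′⊢L
    strengthen Δ {B} B∈Δ B⇒C (A ∷ L) (inj₂ refl ∷ hs) =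
      let L′ , L′⊆Δ , L′⊢L = strengthen Δ B∈Δ B⇒C L hs
      in B ∷ L′ , B∈Δ ∷ L′⊆Δ , B⇒C ∷ L′⊢L

    -- A maxiconsistent set is closed under provable implication: Δ ∪ {C} is
    -- consistent because any refutation of it refutes Δ itself.
    maxcons-closed : ∀ {Δ B C} → MaxCons CS Δ → Δ B → CS ⊢ B ⇒ C → Δ C
    maxcons-closed {Δ} {C = C} (consistent , maximal) B∈Δ B⇒C =
      maximal C λ L L⊆Δ∪C refutation →
        let L′ , L′⊆Δ , L′⊢L = strengthen Δ B∈Δ B⇒C L L⊆Δ∪C
        in consistent L′ L′⊆Δ (⊢-trans (⋀-mono L′⊢L) refutation)

    ⊢K□⇒K : ∀ {A} → CS ⊢ K (□ A) ⇒ K A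
    ⊢K□⇒K {A} = mp (ax (A7K (□ A) A)) (necK (ax (A1□T A)))

    module BoxTransfer {Γ Δ : Pred} (mΓ : MaxCons CS Γ) (mΔ : MaxCons CS Δ)
                       (□Γ⊆Δ : ∀ A → Γ (□ A) → Δ (□ A)) where

      box-elim : ∀ A → Γ (□ A) → Δ A
      box-elim A □A∈Γ = maxcons-closed mΔ (□Γ⊆Δ A □A∈Γ) (ax (A1□T A))

      -- KA ∈ Γ ⇒ □K□A ∈ Γ ⇒ K□A ∈ Δ ⇒ KA ∈ Δ.
      K-transfer : ∀ A → Γ (K A) → Δ (K A)
      K-transfer A KA∈Γ =
        maxcons-closed mΔ (box-elim (K (□ A)) (maxcons-closed mΓ KA∈Γ (ax (A8 A)))) ⊢K□⇒K

      -- Proven(t,A) ∈ Γ ⇒ K Proven(t,A) ∈ Γ ⇒ K Proven(t,A) ∈ Δ ⇒ Proven(t,A) ∈ Δ.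
      Proven-transfer : ∀ t A → Γ (Proven t A) → Δ (Proven t A)
      Proven-transfer t A proven∈Γ =
        maxcons-closed mΔ
          (K-transfer (Proven t A)
            (maxcons-closed mΓ proven∈Γ (⊢-trans (ax (B11 t A)) ⊢-∧-elimˡ)))
          (ax (A7T (Proven t A)))

  -- Δ inherits from Γ every formula that an element carries forward into the
  -- next set: all K-formulas and all Proven-formulas.
  Inherits : Pred → Pred → Set
  Inherits Γ Δ = (∀ A → Γ (K A) → Δ (K A)) × (∀ t A → Γ (Proven t A) → Δ (Proven t A))

  -- The last set of an element may be replaced by any maxiconsistent set
  -- inheriting its K- and Proven-formulas: the last set is constrained only
  -- as the successor of its predecessor.
  replace-last : ∀ {CS n} {Γs : Vec Pred n} {Γ Δ : Pred} →
                 IsElement CS (Γs ∷ʳ Γ) → MaxCons CS Δ → Inherits Γ Δ →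
                 IsElement CS (Γs ∷ʳ Δ)
  replace-last {CS} {Γs = Γs} {Γ} {Δ} el mΔ (K⊆ , Proven⊆) = record
    { maxcons = λ p → lookup-∷ʳ-transport (MaxCons CS) Γs (λ _ → mΔ) p (maxcons p)
    ; keepK   = λ i A KA∈Γᵢ →
        lookup-∷ʳ-transport (λ X → X (K A)) Γs (K⊆ A) (fsuc i)
          (keepK i A (unchanged i (K A) KA∈Γᵢ))
    ; proven  = λ i j t A prove∈Γᵢ →
        lookup-∷ʳ-transport (λ X → X (Proven t A)) Γs (Proven⊆ t A) (fsuc i)
          (proven i j t A (unchanged i (Prove j t A) prove∈Γᵢ))
    }
    where
    open IsElement el
    unchanged : ∀ i F → lookup (Γs ∷ʳ Δ) (inject₁ i) F → lookup (Γs ∷ʳ Γ) (inject₁ i) F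
    unchanged i F h =
      subst (λ X → X F) (sym (lookup-∷ʳ-inject₁ Γs Γ i))
        (subst (λ X → X F) (lookup-∷ʳ-inject₁ Γs Δ i) h)

  ≡ₑ-replace-last : ∀ {n} (Γs : Vec Pred n) {Γ Δ : Pred} →
                    (∀ A → Γ (□ A) → Δ A) → (Γs ∷ʳ Γ) ≡ₑ (Γs ∷ʳ Δ)
  ≡ₑ-replace-last Γs {Γ} {Δ} □Γ⊆Δ = record
    { prefix = λ i A → mk⇔ (same i Γ Δ A) (same i Δ Γ A)
    ; boxes  = λ A □A∈Γ →
        subst (λ X → X A) (sym (last-∷ʳ Δ Γs))
          (□Γ⊆Δ A (subst (λ X → X (□ A)) (last-∷ʳ Γ Γs) □A∈Γ))
    }
    where
    same : ∀ i X Y A → lookup (Γs ∷ʳ X) (inject₁ i) A → lookup (Γs ∷ʳ Y) (inject₁ i) A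
    same i X Y A h =
      subst (λ Z → Z A) (sym (lookup-∷ʳ-inject₁ Γs Y i))
        (subst (λ Z → Z A) (lookup-∷ʳ-inject₁ Γs X i) h)

lemma6 : (k : ℕ) → let open Lang k in
    (CS : Pred) → IsCS CS →
    (n : ℕ) (Γs : Vec Pred n) (Γ Δ : Pred) →
    IsElement CS (Γs ∷ʳ Γ) →
    MaxCons CS Δ →
    (∀ A → Γ (□ A) → Δ (□ A)) →
    IsElement CS (Γs ∷ʳ Δ) × ((Γs ∷ʳ Γ) ≡ₑ (Γs ∷ʳ Δ))
lemma6 k CS _ n Γs Γ Δ el mΔ □Γ⊆Δ =
  replace-last el mΔ (K-transfer , Proven-transfer) , ≡ₑ-replace-last Γs box-elim
  where
  open Lang k using (MaxCons; module IsElement)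
  mΓ : MaxCons CS Γ
  mΓ = subst (MaxCons CS) (lookup-∷ʳ-fromℕ Γs Γ) (IsElement.maxcons el (fromℕ n))
  open BoxTransfer mΓ mΔ □Γ⊆Δ
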